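{- Let $n\geq 3$. A color graph associated to a polygon with $n$ sides can be embedded in a hypercube of dimension no greater than $\left\lfloor \frac{n(3n-8)}{16}\right\rfloor$.
   Context: Let $V=\mathbb{Z}_2\times\mathbb{Z}_2$ be the Klein four-group with elements $0,1,2,3$ ($1+2+3=0$, $x+x=0$). A color graph associated to a polygon with $n$ sides is defined as follows: the vertices of a convex $n$-gon $P$ are colored by elements of $V$ so that adjacent polygon vertices have different colors; a triangulation of $P$ (using only the vertices of $P$) is compatible with the coloring if every diagonal of the triangulation joins differently colored vertices; the color graph has as vertices the compatible triangulations, two being adjacent iff they differ by a single diagonal flip. For a finite set $S$ with $|S|=k$, the $k$-dimensional hypercube $\mathcal{H}(S)$ has vertex set the power set of $S$, with $A,B$ adjacent iff $A\Delta B$ is a singleton. A graph embeds in a hypercube if it is isomorphic to a subgraph of it. -}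

module Defs where

open import Data.Nat using (ℕ; zero; suc; _+_; _*_; _∸_; _≤_; _<_)
open import Data.Nat.DivMod using (_/_)
open import Data.Fin using (Fin; toℕ)
open import Data.Bool using (Bool; true; false)
open import Data.Vec using (Vec; lookup)
open import Data.Product using (Σ; _×_; _,_; ∃; ∃-syntax)
open import Data.Sum using (_⊎_)
open import Relation.Nullary using (¬_)
open import Relation.Binary.PropositionalEquality using (_≡_; _≢_)

-- The Klein four-group V = Z2 × Z2, elements 0,1,2,3 encoded as Fin 4.
-- (Only equality of colours matters for the definitions below.)
V : Set
V = Fin 4

-- Vertices of the convex n-gon P are 0,1,...,n-1 in cyclic order.
-- Two polygon vertices are adjacent (joined by a side of P).
PolyAdj : {n : ℕ} → Fin n → Fin n → Set
PolyAdj {n} i j =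
  (suc (toℕ i) ≡ toℕ j) ⊎ (suc (toℕ j) ≡ toℕ i)
  ⊎ (toℕ i ≡ 0 × suc (toℕ j) ≡ n) ⊎ (toℕ j ≡ 0 × suc (toℕ i) ≡ n)

ProperColoring : {n : ℕ} → (Fin n → V) → Set
ProperColoring {n} c = ∀ (i j : Fin n) → PolyAdj i j → c i ≢ c j

-- a diagonal, written with its endpoints (i , j) in increasing order i < j:
-- i and j are not equal and not adjacent on the polygon
IsDiag : {n : ℕ} → Fin n → Fin n → Set
IsDiag {n} i j = (toℕ i + 2 ≤ toℕ j) × (toℕ i ≡ 0 → suc (toℕ j) < n)

Crosses : {n : ℕ} → Fin n → Fin n → Fin n → Fin n → Set
Crosses i j k l =
  (toℕ i < toℕ k × toℕ k < toℕ j × toℕ j < toℕ l)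
  ⊎ (toℕ k < toℕ i × toℕ i < toℕ l × toℕ l < toℕ j)

-- A set of diagonals is encoded as an n×n Boolean matrix;
-- entry (i , j) = true means the diagonal (i , j) with i < j is in the set.
DiagSet : ℕ → Set
DiagSet n = Vec (Vec Bool n) n

Mem : {n : ℕ} → DiagSet n → Fin n → Fin n → Set
Mem T i j = lookup (lookup T i) j ≡ true

IsTriangulation : {n : ℕ} → DiagSet n → Set
IsTriangulation {n} T =
  (∀ (i j : Fin n) → Mem T i j → IsDiag i j)
  × (∀ (i j k l : Fin n) → Mem T i j → Mem T k l → ¬ Crosses i j k l)
  × (∀ (i j : Fin n) → IsDiag i j → ¬ Mem T i j →
       ∃[ k ] ∃[ l ] (Mem T k l × Crosses i j k l))

Compatible : {n : ℕ} → (Fin n → V) → DiagSet n → Set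
Compatible {n} c T = ∀ (i j : Fin n) → Mem T i j → c i ≢ c j

IsColorGraphVertex : {n : ℕ} → (Fin n → V) → DiagSet n → Set
IsColorGraphVertex c T = IsTriangulation T × Compatible c T

FlipAdj : {n : ℕ} → DiagSet n → DiagSet n → Set
FlipAdj {n} T T' =
  Σ (Fin n) λ i → Σ (Fin n) λ j → Σ (Fin n) λ k → Σ (Fin n) λ l →
    Mem T i j × ¬ Mem T' i j × Mem T' k l × ¬ Mem T k l
    × (∀ (a b : Fin n) → Mem T a b → ¬ Mem T' a b → (a ≡ i × b ≡ j))
    × (∀ (a b : Fin n) → Mem T' a b → ¬ Mem T a b → (a ≡ k × b ≡ l))

-- The hypercube H(S), |S| = k: vertices are subsets of S (Boolean vectors of length k),
-- adjacent iff their symmetric difference is a singleton.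
HypercubeAdj : {k : ℕ} → Vec Bool k → Vec Bool k → Set
HypercubeAdj {k} A B =
  Σ (Fin k) λ p → (lookup A p ≢ lookup B p)
    × (∀ (q : Fin k) → q ≢ p → lookup A q ≡ lookup B q)

EmbedsInHypercube : {n : ℕ} → (Fin n → V) → ℕ → Set
EmbedsInHypercube {n} c k =
  Σ (DiagSet n → Vec Bool k) λ f →
    (∀ T T' → IsColorGraphVertex c T → IsColorGraphVertex c T' → f T ≡ f T' → T ≡ T')
    × (∀ T T' → IsColorGraphVertex c T → IsColorGraphVertex c T' →
         FlipAdj T T' → HypercubeAdj (f T) (f T'))

-- ⌊ n (3n - 8) / 16 ⌋  (for n ≥ 3 the subtraction is exact)
bound : ℕ → ℕ
bound n = (n * (3 * n ∸ 8)) / 16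

-- Fix a colour x ∈ V.  Call a diagonal a coordinate if it joins two different
-- colours, both different from x, and send a compatible triangulation to the
-- set of coordinates it contains.
--  * Flips become hypercube edges: the four vertices of a flip get four
--    different colours (every side of the flipped quadrilateral is a side of P
--    or a diagonal of the triangulation), so exactly one of the two flipped
--    diagonals avoids x, and it is the only coordinate that changes.
--  * The map is injective: a diagonal missing from the other triangulation is
--    no coordinate, so one endpoint has colour x; the fan lemma then yields a
--    crossing diagonal of the other triangulation whose endpoints are joined to
--    that endpoint, hence avoid x — a coordinate, contradicting non-crossing.
--  * Counting over the four colours, the best x has at most ⌊n(3n − 8)/16⌋
--    coordinates (Cauchy–Schwarz over the colour classes).

module Submission where

open import Defs
open import Data.Nat using (ℕ; _≤_)
open import Data.Fin using (Fin)
open import Data.Product using (Σ; _×_)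

open import Data.Nat as ℕ using (zero; suc; _+_; _*_; _∸_; _<_; z≤n; s≤s)
open import Data.Nat.Properties
open import Data.Fin as F using (toℕ; fromℕ<)
open import Data.Fin.Properties using (toℕ<n; toℕ-fromℕ<; injective⇒≤)
import Data.Fin.Properties as FinP
open import Data.Bool using (Bool; true; false; if_then_else_)
import Data.Bool as B
open import Data.Vec as Vec using (Vec; lookup)
open import Data.Product using (_,_; proj₁; proj₂; ∃; ∃₂)
open import Data.Sum using (_⊎_; inj₁; inj₂; [_,_]′)
open import Data.Empty using (⊥; ⊥-elim)
open import Data.Unit using (tt)
open import Relation.Nullary using (¬_; Dec; yes; no; does)
open import Relation.Nullary.Decidable using (_×-dec_; _⊎-dec_; _→-dec_; ¬?)
open import Relation.Binary.PropositionalEquality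
open import Algebra.Properties.Semiring.Sum +-*-semiring
  using (sum; sum-syntax; ∑-comm; ∑-distrib-+; *-distribˡ-sum; *-distribʳ-sum; sum-cong-≗)
import Data.Nat.ListAction as ListSum
open import Data.Nat.ListAction.Properties using (sum-++)
open import Data.List.Properties using (map-++; map-∘; map-tabulate)
open import Data.Nat.Tactic.RingSolver using (solve-∀)
open import Function using (_∘_)
open import Data.Nat.DivMod using (_/_; m*n/n≡m; /-monoˡ-≤)
import Data.List as List
open import Data.List using (List; []; _∷_; length; filter; cartesianProduct; allFin)
open import Data.List.Relation.Unary.Unique.Propositional.Properties using (filter⁺; cartesianProduct⁺; allFin⁺)
import Data.List.Relation.Unary.Any as Any
open import Data.List.Relation.Unary.Any.Properties using (lookup-index)
open import Data.List.Membership.Propositional using (_∈_)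
open import Data.List.Relation.Unary.Unique.Propositional using (Unique)
open import Data.List.Relation.Unary.AllPairs using ([]; _∷_)
open import Data.List.Relation.Unary.All using ([]; _∷_)
import Data.List.Relation.Unary.All as All
open import Data.List.Membership.Propositional.Properties using (∈-lookup; ∈-filter⁺; ∈-filter⁻; ∈-cartesianProduct⁺; ∈-allFin)
open import Data.Vec.Properties using (lookup∘tabulate; tabulate∘lookup; tabulate-cong)

polyAdj? : ∀ {n} (i j : Fin n) → Dec (PolyAdj i j)
polyAdj? {n} i j =
  (suc (toℕ i) ℕ.≟ toℕ j) ⊎-dec ((suc (toℕ j) ℕ.≟ toℕ i) ⊎-dec
  (((toℕ i ℕ.≟ 0) ×-dec (suc (toℕ j) ℕ.≟ n)) ⊎-dec ((toℕ j ℕ.≟ 0) ×-dec (suc (toℕ i) ℕ.≟ n))))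

mem? : ∀ {n} (T : DiagSet n) (i j : Fin n) → Dec (Mem T i j)
mem? T i j = lookup (lookup T i) j B.≟ true

isDiag? : ∀ {n} (i j : Fin n) → Dec (IsDiag i j)
isDiag? {n} i j = (toℕ i + 2 ℕ.≤? toℕ j) ×-dec ((toℕ i ℕ.≟ 0) →-dec (suc (toℕ j) ℕ.<? n))

polyAdj-sym : ∀ {n} {i j : Fin n} → PolyAdj i j → PolyAdj j i
polyAdj-sym (inj₁ e)               = inj₂ (inj₁ e)
polyAdj-sym (inj₂ (inj₁ e))        = inj₁ e
polyAdj-sym (inj₂ (inj₂ (inj₁ e))) = inj₂ (inj₂ (inj₂ e))
polyAdj-sym (inj₂ (inj₂ (inj₂ e))) = inj₂ (inj₂ (inj₁ e))

nonAdjacent⇒diagonal : ∀ {n} (u w : Fin n) → toℕ u < toℕ w → ¬ PolyAdj u w → IsDiag u w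
nonAdjacent⇒diagonal u w u<w ¬adj =
  subst (_≤ toℕ w) (+-comm 2 (toℕ u)) (≤∧≢⇒< u<w (λ e → ¬adj (inj₁ e))) ,
  λ u≡0 → ≤∧≢⇒< (toℕ<n w) (λ e → ¬adj (inj₂ (inj₂ (inj₁ (u≡0 , e)))))

diagonal-gap : ∀ {n} {i j : Fin n} → IsDiag i j → suc (suc (toℕ i)) ≤ toℕ j
diagonal-gap {i = i} {j} d = subst (_≤ toℕ j) (+-comm (toℕ i) 2) (proj₁ d)

diagonal⇒nonAdjacent : ∀ {n} {i j : Fin n} → IsDiag i j → ¬ PolyAdj i j
diagonal⇒nonAdjacent d (inj₁ e)                       = <-irrefl e (diagonal-gap d)
diagonal⇒nonAdjacent d (inj₂ (inj₁ e))                = <-asym (≤-trans (n≤1+n _) (diagonal-gap d)) (≤-reflexive e)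
diagonal⇒nonAdjacent d (inj₂ (inj₂ (inj₁ (i≡0 , e)))) = <-irrefl e (proj₂ d i≡0)
diagonal⇒nonAdjacent d (inj₂ (inj₂ (inj₂ (j≡0 , _)))) with () ← subst (_ ≤_) j≡0 (diagonal-gap d)

diagonal-asym : ∀ {n} {i j : Fin n} → IsDiag i j → ¬ IsDiag j i
diagonal-asym d d' = <-asym (≤-trans (n≤1+n _) (diagonal-gap d)) (≤-trans (n≤1+n _) (diagonal-gap d'))

crossing⇒distinctEnds : ∀ {n} {u w r t : Fin n} → Crosses u w r t →
                        (r ≢ u) × (r ≢ w) × (t ≢ u) × (t ≢ w)
crossing⇒distinctEnds (inj₁ (u<r , r<w , w<t)) =
  (λ e → <-irrefl (cong toℕ (sym e)) u<r) , (λ e → <-irrefl (cong toℕ e) r<w) ,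
  (λ e → <-irrefl (cong toℕ (sym e)) (<-trans u<r (<-trans r<w w<t))) , (λ e → <-irrefl (cong toℕ (sym e)) w<t)
crossing⇒distinctEnds (inj₂ (r<u , u<t , t<w)) =
  (λ e → <-irrefl (cong toℕ e) r<u) , (λ e → <-irrefl (cong toℕ e) (<-trans r<u (<-trans u<t t<w))) ,
  (λ e → <-irrefl (cong toℕ (sym e)) u<t) , (λ e → <-irrefl (cong toℕ e) t<w)

twoNeighbours : ∀ {n} → 3 ≤ n → (i : Fin n) →
                ∃₂ λ j₁ j₂ → PolyAdj i j₁ × PolyAdj i j₂ × j₁ ≢ j₂
twoNeighbours {n} (s≤s (s≤s (s≤s _))) i = neighbours (toℕ i) refl (toℕ<n i)
  where
  vertex : ∀ v → v < n → Σ (Fin n) λ j → toℕ j ≡ v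
  vertex v v<n = fromℕ< v<n , toℕ-fromℕ< v<n

  apart : ∀ {j₁ j₂ : Fin n} {v₁ v₂} → toℕ j₁ ≡ v₁ → toℕ j₂ ≡ v₂ → v₁ ≢ v₂ → j₁ ≢ j₂
  apart e₁ e₂ v₁≢v₂ j₁≡j₂ = v₁≢v₂ (trans (sym e₁) (trans (cong toℕ j₁≡j₂) e₂))

  -- i = 0 has neighbours 1 and n − 1; otherwise i − 1 and either i + 1 or 0.
  neighbours : ∀ v → toℕ i ≡ v → v < n → ∃₂ λ j₁ j₂ → PolyAdj i j₁ × PolyAdj i j₂ × j₁ ≢ j₂
  neighbours zero i≡0 _ with vertex 1 (s≤s (s≤s z≤n)) | vertex (ℕ.pred n) ≤-refl
  ... | j₁ , e₁ | j₂ , e₂ =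
    j₁ , j₂ , inj₁ (trans (cong suc i≡0) (sym e₁)) , inj₂ (inj₂ (inj₁ (i≡0 , cong suc e₂))) ,
    apart e₁ e₂ (λ ())
  neighbours (suc u) i≡v v<n with suc (suc u) ℕ.<? n
  ... | yes v+1<n with vertex u (<-trans (n<1+n u) v<n) | vertex (suc (suc u)) v+1<n
  ...   | j₁ , e₁ | j₂ , e₂ =
    j₁ , j₂ , inj₂ (inj₁ (trans (cong suc e₁) (sym i≡v))) , inj₁ (trans (cong suc i≡v) (sym e₂)) ,
    apart e₁ e₂ (λ e → <-irrefl e (<-trans (n<1+n u) (n<1+n (suc u))))
  neighbours (suc u) i≡v v<n | no v+1≮n with vertex u (<-trans (n<1+n u) v<n) | vertex 0 (≤-trans (s≤s z≤n) v<n)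
  ...   | j₁ , e₁ | j₂ , e₂ =
    j₁ , j₂ , inj₂ (inj₁ (trans (cong suc e₁) (sym i≡v))) ,
    inj₂ (inj₂ (inj₂ (e₂ , trans (cong suc i≡v) (≤-antisym v<n (≮⇒≥ v+1≮n))))) ,
    apart e₁ e₂ (u≢0 (≤-antisym v<n (≮⇒≥ v+1≮n)))
    where
    u≢0 : suc (suc u) ≡ n → u ≢ 0
    u≢0 () refl

-- The fan lemma
--
-- If a diagonal ab is missing from a triangulation T, then some diagonal
-- pq of T crosses ab with p and q both joined to a (and likewise for b):
-- pq is the side opposite a of the triangle of T that ab leaves a through.
-- It is found by a walk: starting from any diagonal of T crossing ab
-- (maximality), an endpoint not yet joined to a gives a diagonal ap of P
-- missing from T, which is crossed by a diagonal of T closer to a.  The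
-- walk terminates because the interval cut off by the current diagonal
-- shrinks; the measure is passed as explicit fuel.

-- The walks measure the current diagonal rt by  t + (n ∸ r)  or  r + (n ∸ t);
-- moving its endpoints inwards shrinks the measure.
measure-shrinksˡ : ∀ {n x x' y y'} → x' < x → y ≤ y' → x' + (n ∸ y') < x + (n ∸ y)
measure-shrinksˡ {n} x'<x y≤y' = +-mono-<-≤ x'<x (∸-monoʳ-≤ n y≤y')

measure-shrinksʳ : ∀ {n x x' y y'} → x' ≤ x → y < y' → y' ≤ n → x' + (n ∸ y') < x + (n ∸ y)
measure-shrinksʳ x'≤x y<y' y'≤n = +-mono-≤-< x'≤x (∸-monoʳ-< y<y' y'≤n)

Joined : ∀ {n} → DiagSet n → Fin n → Fin n → Set
Joined T v p = PolyAdj v p ⊎ Mem T v p ⊎ Mem T p v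

module Fan {n : ℕ} (T : DiagSet n) (tri : IsTriangulation T) where
  private
    nonCrossing : ∀ i j k l → Mem T i j → Mem T k l → ¬ Crosses i j k l
    nonCrossing = proj₁ (proj₂ tri)

    maximal : ∀ i j → IsDiag i j → ¬ Mem T i j → ∃₂ λ k l → Mem T k l × Crosses i j k l
    maximal = proj₂ (proj₂ tri)

    ≤n : ∀ (r : Fin n) → toℕ r ≤ n
    ≤n r = <⇒≤ (toℕ<n r)

  joined? : ∀ v p → Dec (Joined T v p)
  joined? v p = polyAdj? v p ⊎-dec (mem? T v p ⊎-dec mem? T p v)

  FanCrossing : (v a b : Fin n) → Set
  FanCrossing v a b = ∃₂ λ p q → Mem T p q × Crosses a b p q × Joined T v p × Joined T v q

  module Walk (a b : Fin n) where
    towardA-straddlingA : ∀ fuel (p q : Fin n) → Mem T p q → toℕ p < toℕ a → toℕ a < toℕ q → toℕ q < toℕ b →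
                          toℕ q + (n ∸ toℕ p) < fuel → FanCrossing a a b
    towardA-straddlingA zero p q _ _ _ _ ()
    towardA-straddlingA (suc fuel) p q pq p<a a<q q<b μ with joined? a p | joined? a q
    ... | yes ap | yes aq = p , q , pq , inj₂ (p<a , a<q , q<b) , ap , aq
    ... | no ¬ap | _ with maximal p a (nonAdjacent⇒diagonal p a p<a (¬ap ∘ inj₁ ∘ polyAdj-sym)) (¬ap ∘ inj₂ ∘ inj₂)
    ...   | r , t , rt , inj₁ (p<r , r<a , a<t) =
      let t≤q = ≮⇒≥ (λ q<t → nonCrossing p q r t pq rt (inj₁ (p<r , <-trans r<a a<q , q<t))) in
      towardA-straddlingA fuel r t rt r<a a<t (≤-<-trans t≤q q<b) (<-≤-trans (measure-shrinksʳ t≤q p<r (≤n r)) (≤-pred μ))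
    ...   | r , t , rt , inj₂ (r<p , p<t , t<a) = ⊥-elim (nonCrossing p q r t pq rt (inj₂ (r<p , p<t , <-trans t<a a<q)))
    towardA-straddlingA (suc fuel) p q pq p<a a<q q<b μ | yes ap | no ¬aq
      with maximal a q (nonAdjacent⇒diagonal a q a<q (¬aq ∘ inj₁)) (¬aq ∘ inj₂ ∘ inj₁)
    ...   | r , t , rt , inj₁ (a<r , r<q , q<t) = ⊥-elim (nonCrossing p q r t pq rt (inj₁ (<-trans p<a a<r , r<q , q<t)))
    ...   | r , t , rt , inj₂ (r<a , a<t , t<q) =
      let p≤r = ≮⇒≥ (λ r<p → nonCrossing p q r t pq rt (inj₂ (r<p , <-trans p<a a<t , t<q))) in
      towardA-straddlingA fuel r t rt r<a a<t (<-trans t<q q<b) (<-≤-trans (measure-shrinksˡ t<q p≤r) (≤-pred μ))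

    -- Walk towards a, the current diagonal pq straddling b:  a < p < b < q.
    -- Once an endpoint is seen from the other side, the walk continues straddling a.
    towardA-straddlingB : ∀ fuel (p q : Fin n) → Mem T p q → toℕ a < toℕ p → toℕ p < toℕ b → toℕ b < toℕ q →
                          toℕ p + (n ∸ toℕ q) < fuel → FanCrossing a a b
    towardA-straddlingB zero p q _ _ _ _ ()
    towardA-straddlingB (suc fuel) p q pq a<p p<b b<q μ with joined? a p | joined? a q
    ... | yes ap | yes aq = p , q , pq , inj₁ (a<p , p<b , b<q) , ap , aq
    ... | no ¬ap | _ with maximal a p (nonAdjacent⇒diagonal a p a<p (¬ap ∘ inj₁)) (¬ap ∘ inj₂ ∘ inj₁)
    ...   | r , t , rt , inj₁ (a<r , r<p , p<t) =
      let q≤t = ≮⇒≥ (λ t<q → nonCrossing p q r t pq rt (inj₂ (r<p , p<t , t<q))) in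
      towardA-straddlingB fuel r t rt a<r (<-trans r<p p<b) (<-≤-trans b<q q≤t) (<-≤-trans (measure-shrinksˡ r<p q≤t) (≤-pred μ))
    ...   | r , t , rt , inj₂ (r<a , a<t , t<p) =
      towardA-straddlingA _ r t rt r<a a<t (<-trans t<p p<b) ≤-refl
    towardA-straddlingB (suc fuel) p q pq a<p p<b b<q μ | yes ap | no ¬aq
      with maximal a q (nonAdjacent⇒diagonal a q (<-trans a<p (<-trans p<b b<q)) (¬aq ∘ inj₁)) (¬aq ∘ inj₂ ∘ inj₁)
    ...   | r , t , rt , inj₁ (a<r , r<q , q<t) =
      let r≤p = ≮⇒≥ (λ p<r → nonCrossing p q r t pq rt (inj₁ (p<r , r<q , q<t))) in
      towardA-straddlingB fuel r t rt a<r (≤-<-trans r≤p p<b) (<-trans b<q q<t) (<-≤-trans (measure-shrinksʳ r≤p q<t (≤n t)) (≤-pred μ))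
    ...   | r , t , rt , inj₂ (r<a , a<t , t<q) =
      let t≤p = ≮⇒≥ (λ p<t → nonCrossing p q r t pq rt (inj₂ (<-trans r<a a<p , p<t , t<q))) in
      towardA-straddlingA _ r t rt r<a a<t (≤-<-trans t≤p p<b) ≤-refl

    towardB-straddlingB : ∀ fuel (p q : Fin n) → Mem T p q → toℕ a < toℕ p → toℕ p < toℕ b → toℕ b < toℕ q →
                          toℕ q + (n ∸ toℕ p) < fuel → FanCrossing b a b
    towardB-straddlingB zero p q _ _ _ _ ()
    towardB-straddlingB (suc fuel) p q pq a<p p<b b<q μ with joined? b p | joined? b q
    ... | yes bp | yes bq = p , q , pq , inj₁ (a<p , p<b , b<q) , bp , bq
    ... | no ¬bp | _ with maximal p b (nonAdjacent⇒diagonal p b p<b (¬bp ∘ inj₁ ∘ polyAdj-sym)) (¬bp ∘ inj₂ ∘ inj₂)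
    ...   | r , t , rt , inj₁ (p<r , r<b , b<t) =
      let t≤q = ≮⇒≥ (λ q<t → nonCrossing p q r t pq rt (inj₁ (p<r , <-trans r<b b<q , q<t))) in
      towardB-straddlingB fuel r t rt (<-trans a<p p<r) r<b b<t (<-≤-trans (measure-shrinksʳ t≤q p<r (≤n r)) (≤-pred μ))
    ...   | r , t , rt , inj₂ (r<p , p<t , t<b) = ⊥-elim (nonCrossing p q r t pq rt (inj₂ (r<p , p<t , <-trans t<b b<q)))
    towardB-straddlingB (suc fuel) p q pq a<p p<b b<q μ | yes bp | no ¬bq
      with maximal b q (nonAdjacent⇒diagonal b q b<q (¬bq ∘ inj₁)) (¬bq ∘ inj₂ ∘ inj₁)
    ...   | r , t , rt , inj₁ (b<r , r<q , q<t) = ⊥-elim (nonCrossing p q r t pq rt (inj₁ (<-trans p<b b<r , r<q , q<t)))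
    ...   | r , t , rt , inj₂ (r<b , b<t , t<q) =
      let p≤r = ≮⇒≥ (λ r<p → nonCrossing p q r t pq rt (inj₂ (r<p , <-trans p<b b<t , t<q))) in
      towardB-straddlingB fuel r t rt (<-≤-trans a<p p≤r) r<b b<t (<-≤-trans (measure-shrinksˡ t<q p≤r) (≤-pred μ))

    towardB-straddlingA : ∀ fuel (p q : Fin n) → Mem T p q → toℕ p < toℕ a → toℕ a < toℕ q → toℕ q < toℕ b →
                          toℕ p + (n ∸ toℕ q) < fuel → FanCrossing b a b
    towardB-straddlingA zero p q _ _ _ _ ()
    towardB-straddlingA (suc fuel) p q pq p<a a<q q<b μ with joined? b p | joined? b q
    ... | yes bp | yes bq = p , q , pq , inj₂ (p<a , a<q , q<b) , bp , bq
    ... | _ | no ¬bq with maximal q b (nonAdjacent⇒diagonal q b q<b (¬bq ∘ inj₁ ∘ polyAdj-sym)) (¬bq ∘ inj₂ ∘ inj₂)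
    ...   | r , t , rt , inj₁ (q<r , r<b , b<t) =
      towardB-straddlingB _ r t rt (<-trans a<q q<r) r<b b<t ≤-refl
    ...   | r , t , rt , inj₂ (r<q , q<t , t<b) =
      let r≤p = ≮⇒≥ (λ p<r → nonCrossing p q r t pq rt (inj₁ (p<r , r<q , q<t))) in
      towardB-straddlingA fuel r t rt (≤-<-trans r≤p p<a) (<-trans a<q q<t) t<b (<-≤-trans (measure-shrinksʳ r≤p q<t (≤n t)) (≤-pred μ))
    towardB-straddlingA (suc fuel) p q pq p<a a<q q<b μ | no ¬bp | yes bq
      with maximal p b (nonAdjacent⇒diagonal p b (<-trans p<a (<-trans a<q q<b)) (¬bp ∘ inj₁ ∘ polyAdj-sym)) (¬bp ∘ inj₂ ∘ inj₂)
    ...   | r , t , rt , inj₁ (p<r , r<b , b<t) =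
      let q≤r = ≮⇒≥ (λ r<q → nonCrossing p q r t pq rt (inj₁ (p<r , r<q , <-trans q<b b<t))) in
      towardB-straddlingB _ r t rt (<-≤-trans a<q q≤r) r<b b<t ≤-refl
    ...   | r , t , rt , inj₂ (r<p , p<t , t<b) =
      let q≤t = ≮⇒≥ (λ t<q → nonCrossing p q r t pq rt (inj₂ (r<p , p<t , t<q))) in
      towardB-straddlingA fuel r t rt (<-trans r<p p<a) (<-≤-trans a<q q≤t) t<b (<-≤-trans (measure-shrinksˡ r<p q≤t) (≤-pred μ))

  fanAt-start : ∀ a b → IsDiag a b → ¬ Mem T a b → FanCrossing a a b
  fanAt-start a b d ab∉T with maximal a b d ab∉T
  ... | p , q , pq , inj₁ (a<p , p<b , b<q) = Walk.towardA-straddlingB a b _ p q pq a<p p<b b<q ≤-refl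
  ... | p , q , pq , inj₂ (p<a , a<q , q<b) = Walk.towardA-straddlingA a b _ p q pq p<a a<q q<b ≤-refl

  fanAt-end : ∀ a b → IsDiag a b → ¬ Mem T a b → FanCrossing b a b
  fanAt-end a b d ab∉T with maximal a b d ab∉T
  ... | p , q , pq , inj₁ (a<p , p<b , b<q) = Walk.towardB-straddlingB a b _ p q pq a<p p<b b<q ≤-refl
  ... | p , q , pq , inj₂ (p<a , a<q , q<b) = Walk.towardB-straddlingA a b _ p q pq p<a a<q q<b ≤-refl

-- The four vertices of a flip carry four different colours

joined⇒differentColours : ∀ {n} {c : Fin n → V} {T : DiagSet n} → ProperColoring c → Compatible c T →
                          ∀ {v p} → Joined T v p → c v ≢ c p
joined⇒differentColours proper compatible (inj₁ adj)        = proper _ _ adj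
joined⇒differentColours proper compatible (inj₂ (inj₁ vp)) = compatible _ _ vp
joined⇒differentColours proper compatible (inj₂ (inj₂ pv)) = compatible _ _ pv ∘ sym

-- Let T and T' be compatible triangulations that differ only in the diagonals
-- p₁p₃ and p₂p₄ of the quadrilateral p₁ < p₂ < p₃ < p₄ (each lies in T or T').
-- Every side of the quadrilateral is then a side of P or a diagonal of T, so
-- all six pairs among p₁,…,p₄ have different colours.
module FlipQuadrilateral {n : ℕ} (c : Fin n → V) (proper : ProperColoring c) (T T' : DiagSet n)
  (vT : IsColorGraphVertex c T) (vT' : IsColorGraphVertex c T')
  (p₁ p₂ p₃ p₄ : Fin n) (p₁<p₂ : toℕ p₁ < toℕ p₂) (p₂<p₃ : toℕ p₂ < toℕ p₃) (p₃<p₄ : toℕ p₃ < toℕ p₄)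
  (d₁₃ : Mem T p₁ p₃ ⊎ Mem T' p₁ p₃) (d₂₄ : Mem T p₂ p₄ ⊎ Mem T' p₂ p₄)
  (onlyFlipped : ∀ r t → Mem T r t → ¬ Mem T' r t → (r ≡ p₁ × t ≡ p₃) ⊎ (r ≡ p₂ × t ≡ p₄)) where

  private
    nonCrossingT : ∀ i j k l → Mem T i j → Mem T k l → ¬ Crosses i j k l
    nonCrossingT = proj₁ (proj₂ (proj₁ vT))

    nonCrossingT' : ∀ i j k l → Mem T' i j → Mem T' k l → ¬ Crosses i j k l
    nonCrossingT' = proj₁ (proj₂ (proj₁ vT'))

    maximalT : ∀ i j → IsDiag i j → ¬ Mem T i j → ∃₂ λ k l → Mem T k l × Crosses i j k l
    maximalT = proj₂ (proj₂ (proj₁ vT))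

    compatibleT : Compatible c T
    compatibleT = proj₂ vT

    compatibleT' : Compatible c T'
    compatibleT' = proj₂ vT'

    avoids₁₃ : ∀ r t → Mem T r t → Mem T' r t → ¬ Crosses r t p₁ p₃
    avoids₁₃ r t rt rt' x = [ (λ d → nonCrossingT r t p₁ p₃ rt d x) , (λ d → nonCrossingT' r t p₁ p₃ rt' d x) ]′ d₁₃

    avoids₂₄ : ∀ r t → Mem T r t → Mem T' r t → ¬ Crosses r t p₂ p₄
    avoids₂₄ r t rt rt' x = [ (λ d → nonCrossingT r t p₂ p₄ rt d x) , (λ d → nonCrossingT' r t p₂ p₄ rt' d x) ]′ d₂₄

    Shielded : Fin n → Fin n → Set
    Shielded u w = ∀ r t → Crosses u w r t → Crosses r t p₁ p₃ ⊎ Crosses r t p₂ p₄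

    NotCrossedByFlip : Fin n → Fin n → Set
    NotCrossedByFlip u w = ∀ r t → Crosses u w r t → ¬ ((r ≡ p₁ × t ≡ p₃) ⊎ (r ≡ p₂ × t ≡ p₄))

    -- Such a pair u < w is a side of P or a diagonal of T: otherwise a diagonal
    -- of T crosses it; being no flipped diagonal it also lies in T', yet it
    -- crosses a flipped diagonal.
    side : (u w : Fin n) → toℕ u < toℕ w → Shielded u w → NotCrossedByFlip u w → c u ≢ c w
    side u w u<w shielded notFlip with polyAdj? u w
    ... | yes adj = proper u w adj
    ... | no ¬adj with mem? T u w
    ...   | yes uw = compatibleT u w uw
    ...   | no uw∉T with maximalT u w (nonAdjacent⇒diagonal u w u<w ¬adj) uw∉T
    ...     | r , t , rt , crosses with mem? T' r t
    ...       | no rt∉T' = ⊥-elim (notFlip r t crosses (onlyFlipped r t rt rt∉T'))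
    ...       | yes rt' = ⊥-elim ([ avoids₁₃ r t rt rt' , avoids₂₄ r t rt rt' ]′ (shielded r t crosses))

  colours₁₂ : c p₁ ≢ c p₂
  colours₁₂ = side p₁ p₂ p₁<p₂ shielded notFlip
    where
    shielded : Shielded p₁ p₂
    shielded r t (inj₁ (p₁<r , r<p₂ , p₂<t)) with toℕ t ℕ.<? toℕ p₄
    ... | yes t<p₄ = inj₂ (inj₁ (r<p₂ , p₂<t , t<p₄))
    ... | no t≮p₄  = inj₁ (inj₂ (p₁<r , <-trans r<p₂ p₂<p₃ , <-≤-trans p₃<p₄ (≮⇒≥ t≮p₄)))
    shielded r t (inj₂ (r<p₁ , p₁<t , t<p₂)) = inj₁ (inj₁ (r<p₁ , p₁<t , <-trans t<p₂ p₂<p₃))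
    notFlip : NotCrossedByFlip p₁ p₂
    notFlip r t x (inj₁ (r≡p₁ , _)) = proj₁ (crossing⇒distinctEnds x) r≡p₁
    notFlip r t x (inj₂ (r≡p₂ , _)) = proj₁ (proj₂ (crossing⇒distinctEnds x)) r≡p₂

  colours₂₃ : c p₂ ≢ c p₃
  colours₂₃ = side p₂ p₃ p₂<p₃ shielded notFlip
    where
    shielded : Shielded p₂ p₃
    shielded r t (inj₁ (p₂<r , r<p₃ , p₃<t)) = inj₁ (inj₂ (<-trans p₁<p₂ p₂<r , r<p₃ , p₃<t))
    shielded r t (inj₂ (r<p₂ , p₂<t , t<p₃)) = inj₂ (inj₁ (r<p₂ , p₂<t , <-trans t<p₃ p₃<p₄))
    notFlip : NotCrossedByFlip p₂ p₃
    notFlip r t x (inj₁ (_ , t≡p₃)) = proj₂ (proj₂ (proj₂ (crossing⇒distinctEnds x))) t≡p₃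
    notFlip r t x (inj₂ (r≡p₂ , _)) = proj₁ (crossing⇒distinctEnds x) r≡p₂

  colours₃₄ : c p₃ ≢ c p₄
  colours₃₄ = side p₃ p₄ p₃<p₄ shielded notFlip
    where
    shielded : Shielded p₃ p₄
    shielded r t (inj₁ (p₃<r , r<p₄ , p₄<t)) = inj₂ (inj₂ (<-trans p₂<p₃ p₃<r , r<p₄ , p₄<t))
    shielded r t (inj₂ (r<p₃ , p₃<t , t<p₄)) with toℕ p₁ ℕ.<? toℕ r
    ... | yes p₁<r = inj₁ (inj₂ (p₁<r , r<p₃ , p₃<t))
    ... | no p₁≮r  = inj₂ (inj₁ (≤-<-trans (≮⇒≥ p₁≮r) p₁<p₂ , <-trans p₂<p₃ p₃<t , t<p₄))
    notFlip : NotCrossedByFlip p₃ p₄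
    notFlip r t x (inj₁ (_ , t≡p₃)) = proj₁ (proj₂ (proj₂ (crossing⇒distinctEnds x))) t≡p₃
    notFlip r t x (inj₂ (_ , t≡p₄)) = proj₂ (proj₂ (proj₂ (crossing⇒distinctEnds x))) t≡p₄

  colours₁₄ : c p₁ ≢ c p₄
  colours₁₄ = side p₁ p₄ (<-trans p₁<p₂ (<-trans p₂<p₃ p₃<p₄)) shielded notFlip
    where
    shielded : Shielded p₁ p₄
    shielded r t (inj₁ (p₁<r , r<p₄ , p₄<t)) with toℕ r ℕ.<? toℕ p₃
    ... | yes r<p₃ = inj₁ (inj₂ (p₁<r , r<p₃ , <-trans p₃<p₄ p₄<t))
    ... | no r≮p₃  = inj₂ (inj₂ (<-≤-trans p₂<p₃ (≮⇒≥ r≮p₃) , r<p₄ , p₄<t))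
    shielded r t (inj₂ (r<p₁ , p₁<t , t<p₄)) with toℕ t ℕ.<? toℕ p₃
    ... | yes t<p₃ = inj₁ (inj₁ (r<p₁ , p₁<t , t<p₃))
    ... | no t≮p₃  = inj₂ (inj₁ (<-trans r<p₁ p₁<p₂ , <-≤-trans p₂<p₃ (≮⇒≥ t≮p₃) , t<p₄))
    notFlip : NotCrossedByFlip p₁ p₄
    notFlip r t x (inj₁ (r≡p₁ , _)) = proj₁ (crossing⇒distinctEnds x) r≡p₁
    notFlip r t x (inj₂ (_ , t≡p₄)) = proj₂ (proj₂ (proj₂ (crossing⇒distinctEnds x))) t≡p₄

  colours₁₃ : c p₁ ≢ c p₃
  colours₁₃ = [ compatibleT p₁ p₃ , compatibleT' p₁ p₃ ]′ d₁₃

  colours₂₄ : c p₂ ≢ c p₄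
  colours₂₄ = [ compatibleT p₂ p₄ , compatibleT' p₂ p₄ ]′ d₂₄

-- Four different colours exhaust V

unique-lookup-injective : ∀ {A : Set} {xs : List A} → Unique xs →
                          ∀ {i j} → List.lookup xs i ≡ List.lookup xs j → i ≡ j
unique-lookup-injective (_ ∷ _) {F.zero} {F.zero} _ = refl
unique-lookup-injective (x∉xs ∷ _) {F.zero} {F.suc j} e = ⊥-elim (All.lookup x∉xs (∈-lookup j) e)
unique-lookup-injective (x∉xs ∷ _) {F.suc i} {F.zero} e = ⊥-elim (All.lookup x∉xs (∈-lookup i) (sym e))
unique-lookup-injective (_ ∷ u) {F.suc i} {F.suc j} e = cong F.suc (unique-lookup-injective u e)

unique-length : ∀ {m} {xs : List (Fin m)} → Unique xs → length xs ≤ m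
unique-length u = injective⇒≤ (unique-lookup-injective u)

oneDiagonalAvoids : (x a b c d : V) → a ≢ b → a ≢ c → a ≢ d → b ≢ c → b ≢ d → c ≢ d →
                    (a ≢ x × c ≢ x × (b ≡ x ⊎ d ≡ x)) ⊎ (b ≢ x × d ≢ x × (a ≡ x ⊎ c ≡ x))
oneDiagonalAvoids x a b c d a≢b a≢c a≢d b≢c b≢d c≢d with a F.≟ x | b F.≟ x | c F.≟ x | d F.≟ x
... | yes refl | _ | _ | _         = inj₂ (a≢b ∘ sym , a≢d ∘ sym , inj₁ refl)
... | no _ | _ | yes refl | _      = inj₂ (b≢c , c≢d ∘ sym , inj₂ refl)
... | no _ | yes refl | no _ | _   = inj₁ (a≢b , b≢c ∘ sym , inj₁ refl)
... | no _ | no _ | no _ | yes refl = inj₁ (a≢d , c≢d , inj₂ refl)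
... | no a≢x | no b≢x | no c≢x | no d≢x = ⊥-elim (n≮n 4 (unique-length fiveColours))
  where
  fiveColours : Unique (a ∷ b ∷ c ∷ d ∷ x ∷ [])
  fiveColours = (a≢b ∷ a≢c ∷ a≢d ∷ a≢x ∷ []) ∷ (b≢c ∷ b≢d ∷ b≢x ∷ []) ∷ (c≢d ∷ c≢x ∷ []) ∷ (d≢x ∷ []) ∷ [] ∷ []

flip-sym : ∀ {n} {T T' : DiagSet n} → FlipAdj T T' → FlipAdj T' T
flip-sym (i , j , k , l , ij∈T , ij∉T' , kl∈T' , kl∉T , removed , added) =
  k , l , i , j , kl∈T' , kl∉T , ij∈T , ij∉T' , added , removed

-- The diagonal added by a flip crosses the removed one: being absent from T it
-- is crossed by a diagonal of T, which must be the one missing from T'.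
flip-crosses : ∀ {n} {T T' : DiagSet n} → IsTriangulation T → IsTriangulation T' →
               ((i , j , k , l , _) : FlipAdj T T') → Crosses k l i j
flip-crosses {T' = T'} (_ , _ , maximalT) (diagonalT' , nonCrossingT' , _) (i , j , k , l , _ , _ , kl∈T' , kl∉T , removed , _)
  with maximalT k l (diagonalT' k l kl∈T') kl∉T
... | a , b , ab∈T , crosses with mem? T' a b
...   | yes ab∈T' = ⊥-elim (nonCrossingT' k l a b kl∈T' ab∈T' crosses)
...   | no ab∉T' with removed a b ab∈T ab∉T'
...     | refl , refl = crosses

hypercubeAdj-sym : ∀ {k} {A B : Vec Bool k} → HypercubeAdj A B → HypercubeAdj B A
hypercubeAdj-sym (p , differ , same) = p , differ ∘ sym , λ q q≢p → sym (same q q≢p)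

vec-ext : ∀ {A : Set} {m} {xs ys : Vec A m} → (∀ i → lookup xs i ≡ lookup ys i) → xs ≡ ys
vec-ext {xs = xs} {ys} eq = trans (sym (tabulate∘lookup xs)) (trans (tabulate-cong eq) (tabulate∘lookup ys))

matrix-ext : ∀ {A : Set} {m k} {M N : Vec (Vec A k) m} →
             (∀ i j → lookup (lookup M i) j ≡ lookup (lookup N i) j) → M ≡ N
matrix-ext eq = vec-ext (λ i → vec-ext (eq i))

bool-≡ : (b₁ b₂ : Bool) → (b₁ ≡ true → b₂ ≢ true → ⊥) → (b₂ ≡ true → b₁ ≢ true → ⊥) → b₁ ≡ b₂
bool-≡ true  true  _ _ = refl
bool-≡ true  false f _ = ⊥-elim (f refl (λ ()))
bool-≡ false true  _ g = ⊥-elim (g refl (λ ()))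
bool-≡ false false _ _ = refl

-- The embedding determined by a colour x

module Embedding {n : ℕ} (c : Fin n → V) (proper : ProperColoring c) (x : V) where

  Coordinate : Fin n → Fin n → Set
  Coordinate i j = IsDiag i j × c i ≢ c j × c i ≢ x × c j ≢ x

  coordinate? : (e : Fin n × Fin n) → Dec (Coordinate (proj₁ e) (proj₂ e))
  coordinate? (i , j) = isDiag? i j ×-dec (¬? (c i F.≟ c j) ×-dec (¬? (c i F.≟ x) ×-dec ¬? (c j F.≟ x)))

  allPairs : List (Fin n × Fin n)
  allPairs = cartesianProduct (allFin n) (allFin n)

  coordinates : List (Fin n × Fin n)
  coordinates = filter coordinate? allPairs

  dim : ℕ
  dim = length coordinates

  private
    coordinates-unique : Unique coordinates
    coordinates-unique = filter⁺ coordinate? (cartesianProduct⁺ (allFin⁺ n) (allFin⁺ n))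

    ∈-coordinates : ∀ {i j} → Coordinate i j → (i , j) ∈ coordinates
    ∈-coordinates {i} {j} coord = ∈-filter⁺ coordinate? (∈-cartesianProduct⁺ (∈-allFin i) (∈-allFin j)) coord

    coordinates-valid : ∀ q → Coordinate (proj₁ (List.lookup coordinates q)) (proj₂ (List.lookup coordinates q))
    coordinates-valid q = proj₂ (∈-filter⁻ coordinate? {xs = allPairs} (∈-lookup q))

  bit : DiagSet n → Fin n × Fin n → Bool
  bit T (i , j) = lookup (lookup T i) j

  embed : DiagSet n → Vec Bool dim
  embed T = Vec.tabulate (bit T ∘ List.lookup coordinates)

  SameCoordinates : DiagSet n → DiagSet n → Set
  SameCoordinates T T' = ∀ a b → Coordinate a b → bit T (a , b) ≡ bit T' (a , b)

  embed-same : ∀ T T' → embed T ≡ embed T' → SameCoordinates T T'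
  embed-same T T' e a b coord = begin
    bit T (a , b)                           ≡⟨ cong (bit T) at ⟩
    bit T (List.lookup coordinates q)       ≡⟨ lookup∘tabulate _ q ⟨
    lookup (embed T) q                      ≡⟨ cong (λ v → lookup v q) e ⟩
    lookup (embed T') q                     ≡⟨ lookup∘tabulate _ q ⟩
    bit T' (List.lookup coordinates q)      ≡⟨ cong (bit T') at ⟨
    bit T' (a , b)                          ∎
    where
    open ≡-Reasoning
    q : Fin dim
    q = Any.index (∈-coordinates coord)
    at : (a , b) ≡ List.lookup coordinates q
    at = lookup-index (∈-coordinates coord)

  oneCoordinate⇒adjacent : ∀ T T' (u w : Fin n) → Coordinate u w → bit T (u , w) ≢ bit T' (u , w) →
                           (∀ a b → Coordinate a b → (a , b) ≢ (u , w) → bit T (a , b) ≡ bit T' (a , b)) →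
                           HypercubeAdj (embed T) (embed T')
  oneCoordinate⇒adjacent T T' u w coord differ others = q , differs , agrees
    where
    q : Fin dim
    q = Any.index (∈-coordinates coord)
    at : (u , w) ≡ List.lookup coordinates q
    at = lookup-index (∈-coordinates coord)
    differs : lookup (embed T) q ≢ lookup (embed T') q
    differs e = differ (subst (λ z → bit T z ≡ bit T' z) (sym at)
                  (trans (sym (lookup∘tabulate _ q)) (trans e (lookup∘tabulate _ q))))
    agrees : ∀ q' → q' ≢ q → lookup (embed T) q' ≡ lookup (embed T') q'
    agrees q' q'≢q = trans (lookup∘tabulate _ q') (trans
      (others _ _ (coordinates-valid q') (λ e → q'≢q (unique-lookup-injective coordinates-unique (trans e at))))
      (sym (lookup∘tabulate _ q')))

  flipAlong : ∀ T T' → IsColorGraphVertex c T → ((i , j , k , l , _) : FlipAdj T T') →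
              c i ≢ x → c j ≢ x → (c k ≡ x ⊎ c l ≡ x) → HypercubeAdj (embed T) (embed T')
  flipAlong T T' vT (i , j , k , l , ij∈T , ij∉T' , _ , _ , removed , added) i≢x j≢x kl-x =
    oneCoordinate⇒adjacent T T' i j (proj₁ (proj₁ vT) i j ij∈T , proj₂ vT i j ij∈T , i≢x , j≢x)
      (λ e → ij∉T' (trans (sym e) ij∈T)) unchanged
    where
    unchanged : ∀ a b → Coordinate a b → (a , b) ≢ (i , j) → bit T (a , b) ≡ bit T' (a , b)
    unchanged a b (_ , _ , a≢x , b≢x) ab≢ij = bool-≡ _ _
      (λ ab∈T ab∉T' → let (a≡i , b≡j) = removed a b ab∈T ab∉T' in ab≢ij (cong₂ _,_ a≡i b≡j))
      (λ ab∈T' ab∉T → let (a≡k , b≡l) = added a b ab∈T' ab∉T in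
        [ (λ k≡x → a≢x (trans (cong c a≡k) k≡x)) , (λ l≡x → b≢x (trans (cong c b≡l) l≡x)) ]′ kl-x)

  -- A flip of ij to kl with i < k < j < l: the four colours are different, so
  -- exactly one of ij and kl avoids x, and that coordinate alone changes.
  flip⇒adjacent-ordered : ∀ T T' → IsColorGraphVertex c T → IsColorGraphVertex c T' →
                          (f@(i , j , k , l , _) : FlipAdj T T') → toℕ i < toℕ k → toℕ k < toℕ j → toℕ j < toℕ l →
                          HypercubeAdj (embed T) (embed T')
  flip⇒adjacent-ordered T T' vT vT' f@(i , j , k , l , ij∈T , _ , kl∈T' , _ , removed , _) i<k k<j j<l
    with oneDiagonalAvoids x (c i) (c k) (c j) (c l)
           Q.colours₁₂ Q.colours₁₃ Q.colours₁₄ Q.colours₂₃ Q.colours₂₄ Q.colours₃₄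
    where module Q = FlipQuadrilateral c proper T T' vT vT' i k j l i<k k<j j<l
                       (inj₁ ij∈T) (inj₂ kl∈T') (λ r t rt∈T rt∉T' → inj₁ (removed r t rt∈T rt∉T'))
  ... | inj₁ (i≢x , j≢x , kl-x) = flipAlong T T' vT f i≢x j≢x kl-x
  ... | inj₂ (k≢x , l≢x , ij-x) = hypercubeAdj-sym {A = embed T'} {embed T} (flipAlong T' T vT' (flip-sym {T = T} {T'} f) k≢x l≢x ij-x)

  -- Flips are sent to hypercube edges (the two crossing orientations are
  -- exchanged by reversing the flip).
  flip⇒adjacent : ∀ T T' → IsColorGraphVertex c T → IsColorGraphVertex c T' → FlipAdj T T' →
                  HypercubeAdj (embed T) (embed T')
  flip⇒adjacent T T' vT vT' f with flip-crosses {T = T} {T'} (proj₁ vT) (proj₁ vT') f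
  ... | inj₂ (i<k , k<j , j<l) = flip⇒adjacent-ordered T T' vT vT' f i<k k<j j<l
  ... | inj₁ (k<i , i<l , l<j) = hypercubeAdj-sym {A = embed T'} {embed T} (flip⇒adjacent-ordered T' T vT' vT (flip-sym {T = T} {T'} f) k<i i<l l<j)

  -- If T and T' have the same coordinates, no diagonal of T is crossed by a fan
  -- of T' at an x-coloured vertex v: its endpoints, joined to v, avoid x, so it
  -- is a coordinate of T' and hence a diagonal of T.
  noFanAtColour : ∀ T T' → IsTriangulation T → (vT' : IsColorGraphVertex c T') → SameCoordinates T T' →
                  ∀ {v i j} → Mem T i j → c v ≡ x → ¬ Fan.FanCrossing T' (proj₁ vT') v i j
  noFanAtColour T T' triT vT' same {v} {i} {j} ij∈T v≡x (p , q , pq∈T' , crosses , vp , vq) =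
    proj₁ (proj₂ triT) i j p q ij∈T pq∈T crosses
    where
    avoidsX : ∀ {r} → Joined T' v r → c r ≢ x
    avoidsX vr r≡x = joined⇒differentColours {T = T'} proper (proj₂ vT') vr (trans v≡x (sym r≡x))
    pq∈T : Mem T p q
    pq∈T = trans (same p q (proj₁ (proj₁ vT') p q pq∈T' , proj₂ vT' p q pq∈T' , avoidsX vp , avoidsX vq)) pq∈T'

  -- Triangulations with the same coordinates: every diagonal ij of T lies in T'.
  -- Otherwise ij is no coordinate, so an endpoint has colour x, and the fan of T'
  -- at that endpoint contradicts noFanAtColour.
  sameCoordinates⇒⊆ : ∀ T T' → IsColorGraphVertex c T → IsColorGraphVertex c T' → SameCoordinates T T' →
                      ∀ i j → Mem T i j → Mem T' i j
  sameCoordinates⇒⊆ T T' vT vT' same i j ij∈T with mem? T' i j | c i F.≟ x | c j F.≟ x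
  ... | yes ij∈T' | _ | _ = ij∈T'
  ... | no ij∉T' | no i≢x | no j≢x =
    ⊥-elim (ij∉T' (trans (sym (same i j (proj₁ (proj₁ vT) i j ij∈T , proj₂ vT i j ij∈T , i≢x , j≢x))) ij∈T))
  ... | no ij∉T' | yes i≡x | _ =
    ⊥-elim (noFanAtColour T T' (proj₁ vT) vT' same ij∈T i≡x (Fan.fanAt-start T' (proj₁ vT') i j (proj₁ (proj₁ vT) i j ij∈T) ij∉T'))
  ... | no ij∉T' | no _ | yes j≡x =
    ⊥-elim (noFanAtColour T T' (proj₁ vT) vT' same ij∈T j≡x (Fan.fanAt-end T' (proj₁ vT') i j (proj₁ (proj₁ vT) i j ij∈T) ij∉T'))

  embed-injective : ∀ T T' → IsColorGraphVertex c T → IsColorGraphVertex c T' → embed T ≡ embed T' → T ≡ T'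
  embed-injective T T' vT vT' e = matrix-ext λ i j → bool-≡ _ _
    (λ ij∈T ij∉T' → ij∉T' (sameCoordinates⇒⊆ T T' vT vT' same i j ij∈T))
    (λ ij∈T' ij∉T → ij∉T (sameCoordinates⇒⊆ T' T vT' vT (λ a b coord → sym (same a b coord)) i j ij∈T'))
    where
    same : SameCoordinates T T'
    same = embed-same T T' e

  embeds : EmbedsInHypercube c dim
  embeds = embed , embed-injective , flip⇒adjacent

-- Finite sums and indicators

sum-mono : ∀ {m} {f g : Fin m → ℕ} → (∀ i → f i ≤ g i) → sum f ≤ sum g
sum-mono {zero}  f≤g = z≤n
sum-mono {suc m} f≤g = +-mono-≤ (f≤g F.zero) (sum-mono (f≤g ∘ F.suc))

sum-const : ∀ m a → ∑[ i < m ] a ≡ m * a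
sum-const zero    a = refl
sum-const (suc m) a = cong (a +_) (sum-const m a)

∑²-distrib-+ : ∀ {m k} (f g : Fin m → Fin k → ℕ) →
               ∑[ i < m ] ∑[ j < k ] (f i j + g i j) ≡ ∑[ i < m ] ∑[ j < k ] f i j + ∑[ i < m ] ∑[ j < k ] g i j
∑²-distrib-+ f g = trans (sum-cong-≗ (λ i → ∑-distrib-+ (f i) (g i))) (∑-distrib-+ (λ i → sum (f i)) (λ i → sum (g i)))

belowAverage : ∀ {m} (f : Fin (suc m) → ℕ) → ∃ λ x → suc m * f x ≤ sum f
belowAverage {m} f with minimum f
  where
  minimum : ∀ {k} (g : Fin (suc k) → ℕ) → ∃ λ x → ∀ y → g x ≤ g y
  minimum {zero}  g = F.zero , λ { F.zero → ≤-refl }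
  minimum {suc k} g with minimum (g ∘ F.suc)
  ... | x , min with g F.zero ℕ.≤? g (F.suc x)
  ...   | yes g₀≤ = F.zero , λ { F.zero → ≤-refl ; (F.suc y) → ≤-trans g₀≤ (min y) }
  ...   | no g₀≰  = F.suc x , λ { F.zero → <⇒≤ (≰⇒> g₀≰) ; (F.suc y) → min y }
... | x , min = x , subst (_≤ sum f) (sum-const (suc m) (f x)) (sum-mono min)

𝟙 : ∀ {P : Set} → Dec P → ℕ
𝟙 d = if does d then 1 else 0

𝟙-yes : ∀ {P : Set} (d : Dec P) → P → 𝟙 d ≡ 1
𝟙-yes (yes _) _ = refl
𝟙-yes (no ¬p) p = ⊥-elim (¬p p)

𝟙-no : ∀ {P : Set} (d : Dec P) → ¬ P → 𝟙 d ≡ 0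
𝟙-no (yes p) ¬p = ⊥-elim (¬p p)
𝟙-no (no _)  _  = refl

𝟙-mono : ∀ {P Q : Set} → (P → Q) → (p : Dec P) (q : Dec Q) → 𝟙 p ≤ 𝟙 q
𝟙-mono P⇒Q (yes p) q = ≤-reflexive (sym (𝟙-yes q (P⇒Q p)))
𝟙-mono P⇒Q (no _)  q = z≤n

𝟙-complement : ∀ {P : Set} (p : Dec P) → 𝟙 (¬? p) + 𝟙 p ≡ 1
𝟙-complement (yes _) = refl
𝟙-complement (no _)  = refl

𝟙-disjoint : ∀ {P Q R : Set} → (P → R) → (Q → R) → (P → Q → ⊥) →
             (p : Dec P) (q : Dec Q) (r : Dec R) → 𝟙 p + 𝟙 q ≤ 𝟙 r
𝟙-disjoint P⇒R Q⇒R excl (yes p) (yes q) r = ⊥-elim (excl p q)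
𝟙-disjoint P⇒R Q⇒R excl (yes p) (no _)  r = ≤-reflexive (sym (𝟙-yes r (P⇒R p)))
𝟙-disjoint P⇒R Q⇒R excl (no _)  q       r = 𝟙-mono Q⇒R q r

sum-select : ∀ {m} (a : Fin m) (f : Fin m → ℕ) → ∑[ y < m ] (𝟙 (y F.≟ a) * f y) ≡ f a
sum-select {suc m} F.zero f = begin
  f F.zero + 0 + ∑[ y < m ] (𝟙 (F.suc y F.≟ F.zero) * f (F.suc y)) ≡⟨ cong₂ _+_ (+-identityʳ _) (sum-cong-≗ vanish) ⟩
  f F.zero + ∑[ y < m ] 0                                            ≡⟨ cong (f F.zero +_) (trans (sum-const m 0) (*-zeroʳ m)) ⟩
  f F.zero + 0                                                       ≡⟨ +-identityʳ _ ⟩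
  f F.zero                                                           ∎
  where
  open ≡-Reasoning
  vanish : ∀ y → 𝟙 (F.suc y F.≟ F.zero) * f (F.suc y) ≡ 0
  vanish y = cong (_* f (F.suc y)) (𝟙-no (F.suc y F.≟ F.zero) (λ ()))
sum-select {suc m} (F.suc a) f =
  trans (sum-cong-≗ shift) (sum-select a (f ∘ F.suc))
  where
  shift : ∀ y → 𝟙 (F.suc y F.≟ F.suc a) * f (F.suc y) ≡ 𝟙 (y F.≟ a) * f (F.suc y)
  shift y = cong (_* f (F.suc y)) (≤-antisym (𝟙-mono FinP.suc-injective (F.suc y F.≟ F.suc a) (y F.≟ a))
                                             (𝟙-mono (cong F.suc) (y F.≟ a) (F.suc y F.≟ F.suc a)))

sum-point : ∀ {m} (a : Fin m) → ∑[ y < m ] 𝟙 (y F.≟ a) ≡ 1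
sum-point {m} a = trans (sum-cong-≗ (λ y → sym (*-identityʳ (𝟙 (y F.≟ a))))) (sum-select a (λ _ → 1))

sum-avoiding : ∀ {m} {a b : Fin m} → a ≢ b → 2 + ∑[ y < m ] 𝟙 (¬? (a F.≟ y) ×-dec ¬? (b F.≟ y)) ≤ m
sum-avoiding {m} {a} {b} a≢b = begin
  2 + S                                                        ≡⟨ cong (_+ S) (cong₂ _+_ (sym (sum-point a)) (sym (sum-point b))) ⟩
  ∑[ y < m ] 𝟙 (y F.≟ a) + ∑[ y < m ] 𝟙 (y F.≟ b) + S          ≡⟨ cong (_+ S) (∑-distrib-+ (λ y → 𝟙 (y F.≟ a)) (λ y → 𝟙 (y F.≟ b))) ⟨
  ∑[ y < m ] (𝟙 (y F.≟ a) + 𝟙 (y F.≟ b)) + S                   ≡⟨ ∑-distrib-+ (λ y → 𝟙 (y F.≟ a) + 𝟙 (y F.≟ b)) (λ y → 𝟙 (avoids? y)) ⟨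
  ∑[ y < m ] (𝟙 (y F.≟ a) + 𝟙 (y F.≟ b) + 𝟙 (avoids? y))       ≤⟨ sum-mono atMostOne ⟩
  ∑[ y < m ] 1                                                 ≡⟨ trans (sum-const m 1) (*-identityʳ m) ⟩
  m                                                            ∎
  where
  open ≤-Reasoning
  avoids? : ∀ y → Dec (a ≢ y × b ≢ y)
  avoids? y = ¬? (a F.≟ y) ×-dec ¬? (b F.≟ y)
  S : ℕ
  S = ∑[ y < m ] 𝟙 (avoids? y)
  atMostOne : ∀ y → 𝟙 (y F.≟ a) + 𝟙 (y F.≟ b) + 𝟙 (avoids? y) ≤ 1
  atMostOne y = ≤-trans
    (+-monoˡ-≤ _ (𝟙-disjoint inj₁ inj₂ (λ y≡a y≡b → a≢b (trans (sym y≡a) y≡b)) (y F.≟ a) (y F.≟ b) ((y F.≟ a) ⊎-dec (y F.≟ b))))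
    (𝟙-disjoint _ _ (λ { (inj₁ y≡a) (a≢y , _) → a≢y (sym y≡a) ; (inj₂ y≡b) (_ , b≢y) → b≢y (sym y≡b) })
                ((y F.≟ a) ⊎-dec (y F.≟ b)) (avoids? y) (yes tt))

-- 2ab ≤ a² + b²: writing the larger number as a + d, the difference is d².
twoProducts≤squares : ∀ a b → 2 * (a * b) ≤ a * a + b * b
twoProducts≤squares a b =
  [ ordered , (λ b≤a → subst₂ _≤_ (cong (2 *_) (*-comm b a)) (+-comm (b * b) (a * a)) (ordered b≤a)) ]′ (≤-total a b)
  where
  ordered : ∀ {a b} → a ≤ b → 2 * (a * b) ≤ a * a + b * b
  ordered {a} {b} a≤b = subst (λ z → 2 * (a * z) ≤ a * a + z * z) (m+[n∸m]≡n a≤b)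
                          (subst (2 * (a * (a + (b ∸ a))) ≤_) (expand a (b ∸ a)) (m≤m+n _ ((b ∸ a) * (b ∸ a))))
    where
    expand : ∀ a d → 2 * (a * (a + d)) + d * d ≡ a * a + (a + d) * (a + d)
    expand = solve-∀

sum-squared : ∀ {k} (f : Fin k → ℕ) → sum f * sum f ≤ k * ∑[ i < k ] (f i * f i)
sum-squared {zero}  f = z≤n
sum-squared {suc k} f = begin
  (a + S) * (a + S)                                 ≡⟨ square a S ⟩
  a * a + 2 * (a * S) + S * S                       ≤⟨ +-mono-≤ (+-monoʳ-≤ (a * a) cross) (sum-squared (f ∘ F.suc)) ⟩
  a * a + (k * (a * a) + Q) + k * Q                 ≡⟨ regroup a k Q ⟩
  suc k * (a * a + Q)                               ∎
  where
  open ≤-Reasoning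
  a S Q : ℕ
  a = f F.zero
  S = sum (f ∘ F.suc)
  Q = ∑[ i < k ] (f (F.suc i) * f (F.suc i))
  square : ∀ a S → (a + S) * (a + S) ≡ a * a + 2 * (a * S) + S * S
  square = solve-∀
  regroup : ∀ a k Q → a * a + (k * (a * a) + Q) + k * Q ≡ suc k * (a * a + Q)
  regroup = solve-∀
  cross : 2 * (a * S) ≤ k * (a * a) + Q
  cross = begin
    2 * (a * S)                                     ≡⟨ cong (2 *_) (*-distribˡ-sum a (f ∘ F.suc)) ⟩
    2 * ∑[ i < k ] (a * f (F.suc i))                ≡⟨ *-distribˡ-sum 2 (λ i → a * f (F.suc i)) ⟩
    ∑[ i < k ] (2 * (a * f (F.suc i)))              ≤⟨ sum-mono (λ i → twoProducts≤squares a (f (F.suc i))) ⟩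
    ∑[ i < k ] (a * a + f (F.suc i) * f (F.suc i))  ≡⟨ ∑-distrib-+ (λ _ → a * a) (λ i → f (F.suc i) * f (F.suc i)) ⟩
    ∑[ i < k ] (a * a) + Q                          ≡⟨ cong (_+ Q) (sum-const k (a * a)) ⟩
    k * (a * a) + Q                                 ∎

length-filter : ∀ {A : Set} {P : A → Set} (P? : ∀ x → Dec (P x)) (xs : List A) →
                length (filter P? xs) ≡ ListSum.sum (List.map (𝟙 ∘ P?) xs)
length-filter P? [] = refl
length-filter P? (x ∷ xs) with does (P? x)
... | true  = cong suc (length-filter P? xs)
... | false = length-filter P? xs

sum-cartesianProduct : ∀ {A B : Set} (h : A × B → ℕ) (xs : List A) (ys : List B) →
                       ListSum.sum (List.map h (cartesianProduct xs ys)) ≡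
                       ListSum.sum (List.map (λ a → ListSum.sum (List.map (λ b → h (a , b)) ys)) xs)
sum-cartesianProduct h [] ys = refl
sum-cartesianProduct h (x ∷ xs) ys =
  trans (cong ListSum.sum (map-++ h (List.map (x ,_) ys) (cartesianProduct xs ys)))
  (trans (sum-++ (List.map h (List.map (x ,_) ys)) _)
  (cong₂ _+_ (cong ListSum.sum (sym (map-∘ ys))) (sum-cartesianProduct h xs ys)))

sum-allFin : ∀ {m} (h : Fin m → ℕ) → ListSum.sum (List.map h (allFin m)) ≡ sum h
sum-allFin h = trans (cong ListSum.sum (map-tabulate (λ i → i) h)) (tabulated h)
  where
  tabulated : ∀ {m} (f : Fin m → ℕ) → ListSum.sum (List.tabulate f) ≡ sum f
  tabulated {zero}  f = refl
  tabulated {suc m} f = cong (f F.zero +_) (tabulated (f ∘ F.suc))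

quarterOfHalf : ∀ {k D N} → 4 * k ≤ 2 * D → 8 * D ≤ N → k ≤ N / 16
quarterOfHalf {k} {D} {N} 4k≤2D 8D≤N = subst (_≤ N / 16) (m*n/n≡m k 16) (/-monoˡ-≤ 16 (begin
  k * 16         ≡⟨ sixteen k ⟩
  4 * (4 * k)    ≤⟨ *-monoʳ-≤ 4 4k≤2D ⟩
  4 * (2 * D)    ≡⟨ eight D ⟩
  8 * D          ≤⟨ 8D≤N ⟩
  N              ∎))
  where
  open ≤-Reasoning
  sixteen : ∀ k → k * 16 ≡ 4 * (4 * k)
  sixteen = solve-∀
  eight : ∀ D → 4 * (2 * D) ≡ 8 * D
  eight = solve-∀

-- Counting coordinates
--
-- Let D be the number of compatible diagonals, Q the number of ordered pairs
-- of differently coloured vertices and R = n² − Q that of equally coloured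
-- ones.  A compatible diagonal avoids exactly two colours, so the dimensions
-- of the four embeddings add up to at most 2D.  Every compatible diagonal
-- gives two differently coloured ordered pairs and every vertex two more
-- through its sides, so 2D + 2n ≤ Q; and n² ≤ 4R by Cauchy–Schwarz over the
-- four colour classes.  Hence 16 · min dimₓ ≤ 8D ≤ 4Q − 8n ≤ 3n² − 8n.

module Counting {n : ℕ} (n≥3 : 3 ≤ n) (c : Fin n → V) (proper : ProperColoring c) where
  open ≤-Reasoning

  compatibleDiagonal? : ∀ i j → Dec (IsDiag i j × c i ≢ c j)
  compatibleDiagonal? i j = isDiag? i j ×-dec ¬? (c i F.≟ c j)

  D Q R : ℕ
  D = ∑[ i < n ] ∑[ j < n ] 𝟙 (compatibleDiagonal? i j)
  Q = ∑[ i < n ] ∑[ j < n ] 𝟙 (¬? (c i F.≟ c j))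
  R = ∑[ i < n ] ∑[ j < n ] 𝟙 (c i F.≟ c j)

  dim : V → ℕ
  dim = Embedding.dim c proper

  coordinate : V → Fin n → Fin n → ℕ
  coordinate x i j = 𝟙 (Embedding.coordinate? c proper x (i , j))

  dim≡count : ∀ x → dim x ≡ ∑[ i < n ] ∑[ j < n ] coordinate x i j
  dim≡count x =
    trans (length-filter (Embedding.coordinate? c proper x) (Embedding.allPairs c proper x))
    (trans (sum-cartesianProduct (𝟙 ∘ Embedding.coordinate? c proper x) (allFin n) (allFin n))
    (trans (sum-allFin (λ i → ListSum.sum (List.map (λ j → coordinate x i j) (allFin n))))
           (sum-cong-≗ (λ i → sum-allFin (coordinate x i)))))

  coordinateColours : ∀ i j → ∑[ x < 4 ] coordinate x i j ≤ 2 * 𝟙 (compatibleDiagonal? i j)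
  coordinateColours i j = byDecision (compatibleDiagonal? i j)
    where
    byDecision : (cd : Dec (IsDiag i j × c i ≢ c j)) → ∑[ x < 4 ] coordinate x i j ≤ 2 * 𝟙 cd
    byDecision (no ¬cd) = sum-mono λ x →
      ≤-reflexive (𝟙-no (Embedding.coordinate? c proper x (i , j)) (λ (d , ne , _) → ¬cd (d , ne)))
    byDecision (yes (_ , ci≢cj)) = +-cancelˡ-≤ 2 _ 2 (begin
      2 + ∑[ x < 4 ] coordinate x i j                          ≤⟨ +-monoʳ-≤ 2 (sum-mono λ x →
        𝟙-mono (proj₂ ∘ proj₂) (Embedding.coordinate? c proper x (i , j)) (¬? (c i F.≟ x) ×-dec ¬? (c j F.≟ x))) ⟩
      2 + ∑[ x < 4 ] 𝟙 (¬? (c i F.≟ x) ×-dec ¬? (c j F.≟ x))   ≤⟨ sum-avoiding ci≢cj ⟩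
      4                                                        ∎)

  dims≤2D : ∑[ x < 4 ] dim x ≤ 2 * D
  dims≤2D = begin
    ∑[ x < 4 ] dim x                                      ≡⟨ sum-cong-≗ dim≡count ⟩
    ∑[ x < 4 ] ∑[ i < n ] ∑[ j < n ] coordinate x i j     ≡⟨ ∑-comm (λ x i → ∑[ j < n ] coordinate x i j) ⟩
    ∑[ i < n ] ∑[ x < 4 ] ∑[ j < n ] coordinate x i j     ≡⟨ sum-cong-≗ (λ i → ∑-comm (λ x j → coordinate x i j)) ⟩
    ∑[ i < n ] ∑[ j < n ] ∑[ x < 4 ] coordinate x i j     ≤⟨ sum-mono (λ i → sum-mono (coordinateColours i)) ⟩
    ∑[ i < n ] ∑[ j < n ] (2 * 𝟙 (compatibleDiagonal? i j)) ≡⟨ sum-cong-≗ (λ i → *-distribˡ-sum 2 (λ j → 𝟙 (compatibleDiagonal? i j))) ⟨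
    ∑[ i < n ] (2 * ∑[ j < n ] 𝟙 (compatibleDiagonal? i j)) ≡⟨ *-distribˡ-sum 2 (λ i → ∑[ j < n ] 𝟙 (compatibleDiagonal? i j)) ⟨
    2 * D                                                  ∎

  differentlyColouredPair : ∀ i j →
    𝟙 (compatibleDiagonal? i j) + 𝟙 (compatibleDiagonal? j i) + 𝟙 (polyAdj? i j) ≤ 𝟙 (¬? (c i F.≟ c j))
  differentlyColouredPair i j = ≤-trans
    (+-monoˡ-≤ _ (𝟙-disjoint inj₁ inj₂ (λ (d , _) (d' , _) → diagonal-asym d d')
                   (compatibleDiagonal? i j) (compatibleDiagonal? j i) eitherWay))
    (𝟙-disjoint [ proj₂ , (λ (_ , cj≢ci) → cj≢ci ∘ sym) ]′ (proper i j) notSide eitherWay (polyAdj? i j) (¬? (c i F.≟ c j)))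
    where
    eitherWay : Dec ((IsDiag i j × c i ≢ c j) ⊎ (IsDiag j i × c j ≢ c i))
    eitherWay = compatibleDiagonal? i j ⊎-dec compatibleDiagonal? j i
    notSide : (IsDiag i j × c i ≢ c j) ⊎ (IsDiag j i × c j ≢ c i) → ¬ PolyAdj i j
    notSide (inj₁ (d , _)) adj = diagonal⇒nonAdjacent d adj
    notSide (inj₂ (d , _)) adj = diagonal⇒nonAdjacent d (polyAdj-sym adj)

  sidesAt : ∀ i → 2 ≤ ∑[ j < n ] 𝟙 (polyAdj? i j)
  sidesAt i with twoNeighbours n≥3 i
  ... | j₁ , j₂ , adj₁ , adj₂ , j₁≢j₂ = begin
    2                                                       ≡⟨ cong₂ _+_ (sum-point j₁) (sum-point j₂) ⟨
    ∑[ j < n ] 𝟙 (j F.≟ j₁) + ∑[ j < n ] 𝟙 (j F.≟ j₂)        ≡⟨ ∑-distrib-+ (λ j → 𝟙 (j F.≟ j₁)) (λ j → 𝟙 (j F.≟ j₂)) ⟨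
    ∑[ j < n ] (𝟙 (j F.≟ j₁) + 𝟙 (j F.≟ j₂))                ≤⟨ sum-mono (λ j →
      𝟙-disjoint (λ { refl → adj₁ }) (λ { refl → adj₂ }) (λ j≡j₁ j≡j₂ → j₁≢j₂ (trans (sym j≡j₁) j≡j₂))
                 (j F.≟ j₁) (j F.≟ j₂) (polyAdj? i j)) ⟩
    ∑[ j < n ] 𝟙 (polyAdj? i j)                             ∎

  2D+2n≤Q : D + D + n * 2 ≤ Q
  2D+2n≤Q = begin
    D + D + n * 2                                            ≤⟨ +-monoʳ-≤ (D + D) (subst (_≤ A) (sum-const n 2) (sum-mono sidesAt)) ⟩
    D + D + A                                                ≡⟨ cong (λ z → D + z + A) (∑-comm (λ i j → 𝟙 (compatibleDiagonal? j i))) ⟨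
    D + ∑[ i < n ] ∑[ j < n ] 𝟙 (compatibleDiagonal? j i) + A ≡⟨ cong (_+ A) (∑²-distrib-+ (λ i j → 𝟙 (compatibleDiagonal? i j)) (λ i j → 𝟙 (compatibleDiagonal? j i))) ⟨
    ∑[ i < n ] ∑[ j < n ] (𝟙 (compatibleDiagonal? i j) + 𝟙 (compatibleDiagonal? j i)) + A
      ≡⟨ ∑²-distrib-+ (λ i j → 𝟙 (compatibleDiagonal? i j) + 𝟙 (compatibleDiagonal? j i)) (λ i j → 𝟙 (polyAdj? i j)) ⟨
    ∑[ i < n ] ∑[ j < n ] (𝟙 (compatibleDiagonal? i j) + 𝟙 (compatibleDiagonal? j i) + 𝟙 (polyAdj? i j))
      ≤⟨ sum-mono (λ i → sum-mono (differentlyColouredPair i)) ⟩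
    Q                                                        ∎
    where
    A : ℕ
    A = ∑[ i < n ] ∑[ j < n ] 𝟙 (polyAdj? i j)

  Q+R≡n² : Q + R ≡ n * n
  Q+R≡n² = begin-equality
    Q + R                                                          ≡⟨ ∑²-distrib-+ (λ i j → 𝟙 (¬? (c i F.≟ c j))) (λ i j → 𝟙 (c i F.≟ c j)) ⟨
    ∑[ i < n ] ∑[ j < n ] (𝟙 (¬? (c i F.≟ c j)) + 𝟙 (c i F.≟ c j))  ≡⟨ sum-cong-≗ (λ i → sum-cong-≗ (λ j → 𝟙-complement (c i F.≟ c j))) ⟩
    ∑[ i < n ] ∑[ j < n ] 1                                        ≡⟨ sum-cong-≗ {n} {x = λ _ → ∑[ j < n ] 1} {y = λ _ → n} (λ _ → trans (sum-const n 1) (*-identityʳ n)) ⟩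
    ∑[ i < n ] n                                                   ≡⟨ sum-const n n ⟩
    n * n                                                          ∎

  classSize : V → ℕ
  classSize y = ∑[ j < n ] 𝟙 (y F.≟ c j)

  n≡classSizes : n ≡ ∑[ y < 4 ] classSize y
  n≡classSizes = begin-equality
    n                                        ≡⟨ trans (sum-const n 1) (*-identityʳ n) ⟨
    ∑[ i < n ] 1                             ≡⟨ sum-cong-≗ (λ i → sum-point (c i)) ⟨
    ∑[ i < n ] ∑[ y < 4 ] 𝟙 (y F.≟ c i)      ≡⟨ ∑-comm (λ i y → 𝟙 (y F.≟ c i)) ⟩
    ∑[ y < 4 ] classSize y                   ∎

  R≡classSizes² : R ≡ ∑[ y < 4 ] (classSize y * classSize y)
  R≡classSizes² = begin-equality
    R                                                    ≡⟨ sum-cong-≗ (λ i → sum-select (c i) classSize) ⟨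
    ∑[ i < n ] ∑[ y < 4 ] (𝟙 (y F.≟ c i) * classSize y)   ≡⟨ ∑-comm (λ i y → 𝟙 (y F.≟ c i) * classSize y) ⟩
    ∑[ y < 4 ] ∑[ i < n ] (𝟙 (y F.≟ c i) * classSize y)   ≡⟨ sum-cong-≗ (λ y → *-distribʳ-sum (classSize y) (λ i → 𝟙 (y F.≟ c i))) ⟨
    ∑[ y < 4 ] (classSize y * classSize y)               ∎

  n²≤4R : n * n ≤ 4 * R
  n²≤4R = subst₂ _≤_ (cong₂ _*_ (sym n≡classSizes) (sym n≡classSizes)) (cong (4 *_) (sym R≡classSizes²))
                 (sum-squared classSize)

  8D≤n[3n-8] : 8 * D ≤ n * (3 * n ∸ 8)
  8D≤n[3n-8] = subst (8 * D ≤_) (sym (*-distribˡ-∸ n (3 * n) 8)) (m+n≤o⇒m≤o∸n (8 * D) (+-cancelʳ-≤ (n * n) _ _ (begin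
    8 * D + n * 8 + n * n          ≡⟨ regroup D n ⟩
    4 * (D + D + n * 2) + n * n    ≤⟨ +-mono-≤ (*-monoʳ-≤ 4 2D+2n≤Q) n²≤4R ⟩
    4 * Q + 4 * R                  ≡⟨ *-distribˡ-+ 4 Q R ⟨
    4 * (Q + R)                    ≡⟨ cong (4 *_) Q+R≡n² ⟩
    4 * (n * n)                    ≡⟨ split n ⟩
    n * (3 * n) + n * n            ∎)))
    where
    regroup : ∀ D n → 8 * D + n * 8 + n * n ≡ 4 * (D + D + n * 2) + n * n
    regroup = solve-∀
    split : ∀ n → 4 * (n * n) ≡ n * (3 * n) + n * n
    split = solve-∀

  smallDim : ∃ λ x → dim x ≤ bound n
  smallDim = x , quarterOfHalf {D = D} {N = n * (3 * n ∸ 8)} (≤-trans 4dimₓ≤ dims≤2D) 8D≤n[3n-8]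
    where
    x : V
    x = proj₁ (belowAverage dim)
    4dimₓ≤ : 4 * dim x ≤ ∑[ y < 4 ] dim y
    4dimₓ≤ = proj₂ (belowAverage dim)

theorem3 : (n : ℕ) → 3 ≤ n → (c : Fin n → V) → ProperColoring c →
    Σ ℕ (λ k → (k ≤ bound n) × EmbedsInHypercube c k)
theorem3 n n≥3 c proper = Embedding.dim c proper x , dimₓ≤bound , Embedding.embeds c proper x
  where
  x : V
  x = proj₁ (Counting.smallDim n≥3 c proper)
  dimₓ≤bound : Embedding.dim c proper x ≤ bound n
  dimₓ≤bound = proj₂ (Counting.smallDim n≥3 c proper)
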